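{- Let $\mathbf A=\langle A,\wedge,\vee,\rightarrow,0,1\rangle$ be a connexive Heyting algebra and define $a\Rightarrow b:=a\rightarrow(a\wedge b)$ for $a,b\in A$. Then $\mathbb{H}(\mathbf A)=\langle A,\wedge,\vee,\Rightarrow,0,1\rangle$ is a Heyting algebra.
   Context: A connexive Heyting algebra is an algebra $\mathbf A=\langle A,\wedge,\vee,\rightarrow,0,1\rangle$ of type $\langle 2,2,2,0,0\rangle$ such that $\langle A,\wedge,\vee,0,1\rangle$ is a bounded distributive lattice with bottom $0$, top $1$ and lattice order $\le$, and, writing $\neg x:=x\rightarrow 0$, the following hold for all elements: (C1) $(x\rightarrow y)\rightarrow((y\rightarrow z)\rightarrow(x\rightarrow z))=1$; (C2) $(x\rightarrow y)\rightarrow\neg(x\rightarrow\neg y)=1$; (C3) $x\wedge(x\rightarrow y)=x\wedge y$; (C4) $x\rightarrow y\le(z\wedge x)\rightarrow(z\wedge y)$; (C5) $x\rightarrow y\le(z\vee x)\rightarrow(z\vee y)$. -}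

module Defs where

open import Level using (Level; suc)
open import Algebra.Core using (Op₂)
open import Algebra.Lattice.Structures using (IsDistributiveLattice)
open import Relation.Binary.Core using (Rel)
open import Relation.Binary.PropositionalEquality using (_≡_)
open import Relation.Binary.Lattice.Structures using (IsHeytingAlgebra)

record ConnexiveHeytingAlgebra (c : Level) : Set (suc c) where
  infixr 7 _∧_
  infixr 6 _∨_
  infixr 5 _⟶_
  infix  4 _≤_
  field
    Carrier : Set c
    _∧_ _∨_ _⟶_ : Op₂ Carrier
    𝟘 𝟙 : Carrier

  _≤_ : Rel Carrier c
  x ≤ y = x ∧ y ≡ x

  ¬_ : Carrier → Carrier
  ¬ x = x ⟶ 𝟘

  field
    isDistributiveLattice : IsDistributiveLattice _≡_ _∨_ _∧_
    𝟘-bottom : ∀ x → 𝟘 ≤ x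
    𝟙-top    : ∀ x → x ≤ 𝟙
    C1 : ∀ x y z → (x ⟶ y) ⟶ ((y ⟶ z) ⟶ (x ⟶ z)) ≡ 𝟙
    C2 : ∀ x y → (x ⟶ y) ⟶ (¬ (x ⟶ ¬ y)) ≡ 𝟙
    C3 : ∀ x y → x ∧ (x ⟶ y) ≡ x ∧ y
    C4 : ∀ x y z → (x ⟶ y) ≤ (z ∧ x) ⟶ (z ∧ y)
    C5 : ∀ x y z → (x ⟶ y) ≤ (z ∨ x) ⟶ (z ∨ y)

  infixr 5 _⇒_
  _⇒_ : Op₂ Carrier
  a ⇒ b = a ⟶ (a ∧ b)

IsHeytingℍ : ∀ {c} → ConnexiveHeytingAlgebra c → Set c
IsHeytingℍ A = IsHeytingAlgebra _≡_ _≤_ _∨_ _∧_ _⇒_ 𝟙 𝟘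
  where open ConnexiveHeytingAlgebra A

{-# OPTIONS --safe #-}
module Submission where

-- The derived implication x ⇒ y = x ⟶ (x ∧ y) is a right adjoint of x ∧ _.
-- By (C4) with x := 𝟙 and (C3), w = 𝟙 ⟶ w ≤ x ⇒ w = x ⇒ (w ∧ x); by (C5),
-- x ⟶ _ is monotone on the interval below x, so w ∧ x ≤ y gives w ≤ x ⇒ y.
-- Conversely (C3) is modus ponens x ∧ (x ⇒ y) = x ∧ y ≤ y.  Only (C3)–(C5)
-- are needed.

open import Defs
open import Level using (Level)
open import Data.Product using (_,_)
open import Function using (_∘_)
open import Relation.Binary.Lattice.Structures using (IsLattice; IsHeytingAlgebra)
open import Relation.Binary.Bundles using (Poset)
open import Relation.Binary.Lattice.Bundles using (MeetSemilattice)
import Relation.Binary.Lattice.Properties.MeetSemilattice as MeetSemilatticeProperties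
open import Algebra.Lattice.Bundles using (Lattice)
open import Algebra.Lattice.Structures using (IsDistributiveLattice)
import Algebra.Lattice.Properties.Lattice as LatticeProperties

module _ {c ℓ : Level} (L : Lattice c ℓ) where
  open Lattice L using (_≈_; _∨_; _∧_; sym; isEquivalence)
  open LatticeProperties L using (∨-∧-isOrderTheoreticLattice)
  open IsLattice ∨-∧-isOrderTheoreticLattice
    using (reflexive; trans; antisym; supremum; infimum)

  -- The library orders by x ≈ x ∧ y; here the equation is read the other way round.
  isOrderTheoreticLattice : IsLattice _≈_ (λ x y → x ∧ y ≈ x) _∨_ _∧_
  isOrderTheoreticLattice = record
    { isPartialOrder = record
      { isPreorder = record
        { isEquivalence = isEquivalence
        ; reflexive     = sym ∘ reflexive
        ; trans         = λ p q → sym (trans (sym p) (sym q))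
        }
      ; antisym = λ p q → antisym (sym p) (sym q)
      }
    ; supremum = λ x y → let (x≤x∨y , y≤x∨y , ∨-least) = supremum x y in
        sym x≤x∨y , sym y≤x∨y , λ z p q → sym (∨-least z (sym p) (sym q))
    ; infimum  = λ x y → let (x∧y≤x , x∧y≤y , ∧-greatest) = infimum x y in
        sym x∧y≤x , sym x∧y≤y , λ z p q → sym (∧-greatest z (sym p) (sym q))
    }

module _ {c : Level} (A : ConnexiveHeytingAlgebra c) where
  open ConnexiveHeytingAlgebra A
  open IsDistributiveLattice isDistributiveLattice
    using (isLattice; ∧-comm; ∧-assoc; ∨-comm; ∨-absorbs-∧)
  open import Relation.Binary.PropositionalEquality
    using (_≡_; sym; trans; cong; subst₂; module ≡-Reasoning)

  algebraicLattice : Lattice c c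
  algebraicLattice = record { isLattice = isLattice }

  open LatticeProperties algebraicLattice using (∧-idem)

  ≤-isLattice : IsLattice _≡_ _≤_ _∨_ _∧_
  ≤-isLattice = isOrderTheoreticLattice algebraicLattice

  open IsLattice ≤-isLattice using (isMeetSemilattice; isPartialOrder; x∧y≤x; x∧y≤y)
    renaming (refl to ≤-refl)

  ≤-meetSemilattice : MeetSemilattice c c c
  ≤-meetSemilattice = record { isMeetSemilattice = isMeetSemilattice }

  ≤-poset : Poset c c c
  ≤-poset = record { isPartialOrder = isPartialOrder }

  open MeetSemilatticeProperties ≤-meetSemilattice using (∧-monotonic)

  ∧-identityˡ : ∀ x → 𝟙 ∧ x ≡ x
  ∧-identityˡ x = trans (∧-comm 𝟙 x) (𝟙-top x)

  ≤⇒∨≡ : ∀ {x y} → x ≤ y → x ∨ y ≡ y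
  ≤⇒∨≡ {x} {y} x≤y = begin
    x ∨ y       ≡⟨ cong (_∨ y) (sym x≤y) ⟩
    x ∧ y ∨ y   ≡⟨ cong (_∨ y) (∧-comm x y) ⟩
    y ∧ x ∨ y   ≡⟨ ∨-comm (y ∧ x) y ⟩
    y ∨ y ∧ x   ≡⟨ ∨-absorbs-∧ y x ⟩
    y           ∎
    where open ≡-Reasoning

  ⟶-identityˡ : ∀ x → 𝟙 ⟶ x ≡ x
  ⟶-identityˡ x = begin
    𝟙 ⟶ x         ≡⟨ ∧-identityˡ (𝟙 ⟶ x) ⟨
    𝟙 ∧ (𝟙 ⟶ x)   ≡⟨ C3 𝟙 x ⟩
    𝟙 ∧ x         ≡⟨ ∧-identityˡ x ⟩
    x             ∎
    where open ≡-Reasoning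

  ⟶-monoʳ-below : ∀ {x a b} → a ≤ b → b ≤ x → x ⟶ a ≤ x ⟶ b
  ⟶-monoʳ-below {x} {a} {b} a≤b b≤x =
    subst₂ (λ u v → x ⟶ a ≤ u ⟶ v) (≤⇒∨≡ b≤x) (trans (∨-comm b a) (≤⇒∨≡ a≤b)) (C5 x a b)

  ⇒-inflationary : ∀ x w → w ≤ x ⇒ w
  ⇒-inflationary x w =
    subst₂ (λ u v → u ≤ v ⟶ (x ∧ w)) (⟶-identityˡ w) (𝟙-top x) (C4 𝟙 w x)

  x∧[y∧x]≡x∧y : ∀ x y → x ∧ (y ∧ x) ≡ x ∧ y
  x∧[y∧x]≡x∧y x y = begin
    x ∧ (y ∧ x)   ≡⟨ cong (x ∧_) (∧-comm y x) ⟩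
    x ∧ (x ∧ y)   ≡⟨ ∧-assoc x x y ⟨
    (x ∧ x) ∧ y   ≡⟨ cong (_∧ y) (∧-idem x) ⟩
    x ∧ y         ∎
    where open ≡-Reasoning

  ⇒-modusPonens : ∀ x y → x ∧ (x ⇒ y) ≡ x ∧ y
  ⇒-modusPonens x y = trans (C3 x (x ∧ y)) (trans (cong (x ∧_) (∧-comm x y)) (x∧[y∧x]≡x∧y x y))

  ⇒-monoʳ : ∀ {x a b} → a ≤ b → x ⇒ a ≤ x ⇒ b
  ⇒-monoʳ {x} {a} {b} a≤b = ⟶-monoʳ-below (∧-monotonic ≤-refl a≤b) (x∧y≤x x b)

  open import Relation.Binary.Reasoning.PartialOrder ≤-poset

  ⇒-residual : ∀ w x y → w ∧ x ≤ y → w ≤ x ⇒ y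
  ⇒-residual w x y w∧x≤y = begin
    w               ≤⟨ ⇒-inflationary x w ⟩
    x ⇒ w           ≡⟨ cong (x ⟶_) (x∧[y∧x]≡x∧y x w) ⟨
    x ⇒ (w ∧ x)     ≤⟨ ⇒-monoʳ w∧x≤y ⟩
    x ⇒ y           ∎

  ⇒-counit : ∀ w x y → w ≤ x ⇒ y → w ∧ x ≤ y
  ⇒-counit w x y w≤x⇒y = begin
    w ∧ x           ≤⟨ ∧-monotonic w≤x⇒y ≤-refl ⟩
    (x ⇒ y) ∧ x     ≡⟨ ∧-comm (x ⇒ y) x ⟩
    x ∧ (x ⇒ y)     ≡⟨ ⇒-modusPonens x y ⟩
    x ∧ y           ≤⟨ x∧y≤y x y ⟩
    y               ∎

theorem3p13 : ∀ {c : Level} (A : ConnexiveHeytingAlgebra c) → IsHeytingℍ A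
theorem3p13 A = record
  { isBoundedLattice = record
    { isLattice = ≤-isLattice A
    ; maximum   = 𝟙-top
    ; minimum   = 𝟘-bottom
    }
  ; exponential = λ w x y → ⇒-residual A w x y , ⇒-counit A w x y
  }
  where open ConnexiveHeytingAlgebra A using (𝟙-top; 𝟘-bottom)
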